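{- Let $\mathcal{I}$ be an instance of Grid Tiling with Inequality with parameter $\kappa$ and integer $n$, and let $G_\mathcal{I}$ be the graph constructed from it as described in the context. Then $G_\mathcal{I}$ has pathwidth at most $\kappa+O(1)$.
   Context: An instance $\mathcal{I}$ of Grid Tiling with Inequality consists of positive integers $\kappa,n$ and $\kappa^2$ non-empty sets $S_{i,j}\subseteq[n]^2$, $i,j\in[\kappa]$ (where $[q]=\{1,\dots,q\}$). The graph $G_\mathcal{I}$ is built as follows. For each $(i,j)$, fix an arbitrary ordering $S_{i,j}=\{s_1,\dots,s_\sigma\}$ ($\sigma\le n^2$). The gadget $G_{i,j}$ consists of a cycle $O_{i,j}=(v_1,v_2,\dots,v_{16n^2+4},v_1)$, plus five vertices $x^1_{i,j},x^2_{i,j},x^3_{i,j},x^4_{i,j},y_{i,j}$. The vertex $y_{i,j}$ is adjacent to $v_1,v_{4n^2+2},v_{8n^2+3},v_{12n^2+4}$. For each $\tau\in[\sigma]$, add edges $x^1_{i,j}v_\tau$, $x^2_{i,j}v_{\tau+4n^2+1}$, $x^3_{i,j}v_{\tau+8n^2+2}$, $x^4_{i,j}v_{\tau+12n^2+3}$. (Edge lengths: cycle edges $1$; edges at $y_{i,j}$ length $2n^2+1$; for $s_\tau=(a,b)$ the four edges above have lengths $2n^2-\frac{a}{n+1}$, $2n^2+\frac{b}{n+1}-1$, $2n^2+\frac{a}{n+1}-1$, $2n^2-\frac{b}{n+1}$ respectively; lengths do not affect pathwidth.) Gadgets are connected in a grid: for $j\le\kappa-1$ a path $P_{i,j}$ from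 $x^2_{i,j}$ to $x^4_{i,j+1}$, and for $i\le\kappa-1$ a path $P'_{i,j}$ from $x^3_{i,j}$ to $x^1_{i+1,j}$, each with $n+2$ edges (of length $\frac{1}{n+2}$) and new internal vertices. A path decomposition of a graph $G=(V,E)$ is a path $P$ whose nodes $v$ are labelled by bags $K_v\subseteq V$ such that every vertex lies in some bag, every edge has both endpoints in some bag, and for every vertex the nodes whose bags contain it form a subpath; its width is $\max_v|K_v|-1$, and the pathwidth is the minimum width over all path decompositions. -}

module Defs where

open import Data.Nat using (ℕ; zero; suc; _+_; _*_; _∸_; _≤_; _<_)
open import Data.Nat.DivMod using (_mod_)
open import Data.Fin as Fin using (Fin; toℕ; inject₁; fromℕ)
open import Data.Product using (Σ; ∃; _×_; _,_)
open import Data.List using (List; []; length)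
open import Data.List.Membership.Propositional using (_∈_)
open import Data.List.Relation.Unary.Unique.Propositional using (Unique)
open import Relation.Binary.PropositionalEquality using (_≡_)
open import Relation.Nullary using (¬_)

-- Path decompositions and pathwidth of a graph given by a vertex type V
-- and an adjacency relation E (the graph is undirected: an edge {u,v}
-- is represented by E u v or E v u; the edge condition is symmetric).

record PathDecomposition (V : Set) (E : V → V → Set) : Set₁ where
  field
    m        : ℕ
    bag      : Fin m → List V
    bagSet   : ∀ t → Unique (bag t)
    covers   : ∀ v → ∃ λ t → v ∈ bag t
    edges    : ∀ u v → E u v → ∃ λ t → (u ∈ bag t) × (v ∈ bag t)
    subpath  : ∀ v (a b c : Fin m) → toℕ a ≤ toℕ b → toℕ b ≤ toℕ c →
               v ∈ bag a → v ∈ bag c → v ∈ bag b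

open PathDecomposition public

HasWidth≤ : ∀ {V E} → PathDecomposition V E → ℕ → Set
HasWidth≤ D w = ∀ t → length (bag D t) ≤ suc w

Pathwidth≤ : (V : Set) (E : V → V → Set) → ℕ → Set₁
Pathwidth≤ V E w = Σ (PathDecomposition V E) λ D → HasWidth≤ D w

-- Grid Tiling with Inequality instances.  κ = suc k (κ is positive).
-- [n] is represented by Fin n (value a ∈ [n] ↔ a-1 : Fin n).
-- The list S i j is the chosen (arbitrary) ordering s_1,…,s_σ of S_{i,j}.

record GTI (k n : ℕ) : Set where
  field
    S        : Fin (suc k) → Fin (suc k) → List (Fin n × Fin n)
    S-set    : ∀ i j → Unique (S i j)
    S-nonempty : ∀ i j → ¬ (S i j ≡ [])

open GTI public

cycLen : ℕ → ℕ
cycLen n = 4 + 16 * (n * n)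

-- Gadget indices i j : Fin κ (i = row, j = column).
--  cyc i j t     : vertex v_{t+1} of O_{i,j}   (t : Fin (16n²+4))
--  xv r i j      : x^{r+1}_{i,j}               (r : Fin 4)
--  yv i j        : y_{i,j}
--  hp i j q      : (q+1)-th internal vertex of P_{i,j}, j ∈ [κ-1] (j : Fin k)
--  vp i j q      : (q+1)-th internal vertex of P'_{i,j}, i ∈ [κ-1] (i : Fin k)
-- Each path has n+2 edges, hence n+1 internal vertices (q : Fin (suc n)).
data Vtx (k n : ℕ) : Set where
  cyc : Fin (suc k) → Fin (suc k) → Fin (cycLen n) → Vtx k n
  xv  : Fin 4 → Fin (suc k) → Fin (suc k) → Vtx k n
  yv  : Fin (suc k) → Fin (suc k) → Vtx k n
  hp  : Fin (suc k) → Fin k → Fin (suc n) → Vtx k n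
  vp  : Fin k → Fin (suc k) → Fin (suc n) → Vtx k n

-- v_t of O_{i,j}, 1-indexed (used only for 1 ≤ t ≤ 16n²+4)
v : ∀ {k n} → Fin (suc k) → Fin (suc k) → ℕ → Vtx k n
v {n = n} i j t = cyc i j ((t ∸ 1) mod cycLen n)

x1 x2 x3 x4 : ∀ {k n} → Fin (suc k) → Fin (suc k) → Vtx k n
x1 = xv (Fin.zero)
x2 = xv (Fin.suc Fin.zero)
x3 = xv (Fin.suc (Fin.suc Fin.zero))
x4 = xv (Fin.suc (Fin.suc (Fin.suc Fin.zero)))

-- Edges of G_I (edge lengths are irrelevant for pathwidth and omitted).
data Edge {k n : ℕ} (I : GTI k n) : Vtx k n → Vtx k n → Set where
  cycE : ∀ i j (t : Fin (cycLen n)) →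
         Edge I (cyc i j t) (cyc i j ((suc (toℕ t)) mod cycLen n))
  yE1 : ∀ i j → Edge I (yv i j) (v i j 1)
  yE2 : ∀ i j → Edge I (yv i j) (v i j (4 * (n * n) + 2))
  yE3 : ∀ i j → Edge I (yv i j) (v i j (8 * (n * n) + 3))
  yE4 : ∀ i j → Edge I (yv i j) (v i j (12 * (n * n) + 4))
  xE1 : ∀ i j τ → 1 ≤ τ → τ ≤ length (S I i j) → Edge I (x1 i j) (v i j τ)
  xE2 : ∀ i j τ → 1 ≤ τ → τ ≤ length (S I i j) →
        Edge I (x2 i j) (v i j (τ + 4 * (n * n) + 1))
  xE3 : ∀ i j τ → 1 ≤ τ → τ ≤ length (S I i j) →
        Edge I (x3 i j) (v i j (τ + 8 * (n * n) + 2))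
  xE4 : ∀ i j τ → 1 ≤ τ → τ ≤ length (S I i j) →
        Edge I (x4 i j) (v i j (τ + 12 * (n * n) + 3))
  hStart : ∀ i (j : Fin k) → Edge I (x2 i (inject₁ j)) (hp i j Fin.zero)
  hStep  : ∀ i (j : Fin k) (q : Fin n) → Edge I (hp i j (inject₁ q)) (hp i j (Fin.suc q))
  hEnd   : ∀ i (j : Fin k) → Edge I (hp i j (fromℕ n)) (x4 i (Fin.suc j))
  vStart : ∀ (i : Fin k) j → Edge I (x3 (inject₁ i) j) (vp i j Fin.zero)
  vStep  : ∀ (i : Fin k) j (q : Fin n) → Edge I (vp i j (inject₁ q)) (vp i j (Fin.suc q))
  vEnd   : ∀ (i : Fin k) j → Edge I (vp i j (fromℕ n)) (x1 (Fin.suc i) j)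

module Submission where

open import Defs
open import Data.Nat using (ℕ; NonZero; zero; suc; _+_; _*_; _∸_; _≤_; _<_; _≤?_; z≤n; s≤s)
import Data.Nat as ℕ
open import Data.Nat.Properties hiding (_≟_)
open import Data.Nat.DivMod using (_mod_; _/_; _%_; m<n⇒m%n≡m; n%n≡0; m%n<n; m≡m%n+[m/n]*n)
open import Data.Fin as Fin using (Fin; toℕ; fromℕ; fromℕ<; inject₁; combine)
open import Data.Fin.Patterns using (0F; 1F; 2F; 3F)
open import Data.Fin.Properties
  using ( toℕ<n; toℕ≤n; toℕ≤pred[n]; toℕ-fromℕ; toℕ-fromℕ<; toℕ-inject₁; toℕ-combine
        ; toℕ-injective; inject₁-injective; combine-injectiveˡ; combine-injectiveʳ; injective⇒≤)
open import Data.Product using (∃; _×_; _,_; proj₁; proj₂; uncurry)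
open import Data.Product.Properties using (≡-dec)
open import Data.Sum using (_⊎_; inj₁; inj₂)
open import Data.List
  using (List; []; _∷_; _++_; length; lookup; map; filter; deduplicate; applyUpTo; allFin; cartesianProduct)
open import Data.List.Properties using (length-map; length-applyUpTo)
open import Data.List.Membership.Propositional using (_∈_)
open import Data.List.Membership.Propositional.Properties
  using ( ∈-map⁺; ∈-map⁻; ∈-++⁺ˡ; ∈-++⁺ʳ; ∈-filter⁺; ∈-filter⁻; ∈-deduplicate⁺; ∈-deduplicate⁻
        ; ∈-lookup; ∈-applyUpTo⁺; ∈-allFin; ∈-cartesianProduct⁺)
open import Data.List.Membership.Setoid.Properties using (index-injective)
open import Data.List.Relation.Unary.Any using (here; there)
import Data.List.Relation.Unary.All as All
open import Data.List.Relation.Unary.AllPairs using (_∷_)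
open import Data.List.Relation.Unary.Unique.Propositional using (Unique)
import Data.List.Relation.Unary.Unique.Propositional.Properties as Unique
open import Data.List.Relation.Unary.Unique.DecPropositional.Properties using (deduplicate-!)
open import Data.List.Relation.Binary.Subset.Propositional using (_⊆_)
open import Function using (_∘_)
open import Function.Definitions using (Injective)
open import Relation.Binary.Definitions using (DecidableEquality)
open import Relation.Binary.PropositionalEquality
open import Relation.Nullary using (Dec; yes; no; contradiction)
open import Relation.Nullary.Decidable using (_×-dec_; map′)

-- Sweep the κ² gadgets in row-major order, spending a block of L = 16n² + 2n + 8 time
-- steps on each: walk once around the cycle O_{i,j} (v_{w+1} is alive at offsets w − 1
-- and w, and v₁ until the walk is closed), then along P′_{i,j}, then along P_{i,j},
-- while y_{i,j} and the x's of the gadget stay alive for the whole walk.  Giving every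
-- vertex an interval of time steps yields a path decomposition whose bag at time t is
-- the set of vertices alive at t.  Only the endpoints x¹ and x⁴ of the paths live across
-- blocks, from the start of the block where their path begins; during a block these are
-- the κ + 1 vertices x¹ of the gadgets at most κ blocks ahead and two vertices x⁴.  With
-- at most 10 further vertices of the current gadget, a bag has at most κ + 13 vertices.

module _ {A : Set} where

  lookup-injective : ∀ {xs : List A} → Unique xs → Injective _≡_ _≡_ (lookup xs)
  lookup-injective {_ ∷ _} _        {Fin.zero}  {Fin.zero}  _ = refl
  lookup-injective {_ ∷ _} (x∉ ∷ _) {Fin.zero}  {Fin.suc j} e =
    contradiction e (All.lookup x∉ (∈-lookup j))
  lookup-injective {_ ∷ _} (x∉ ∷ _) {Fin.suc i} {Fin.zero}  e =
    contradiction (sym e) (All.lookup x∉ (∈-lookup i))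
  lookup-injective {_ ∷ _} (_ ∷ u)  {Fin.suc i} {Fin.suc j} e = cong Fin.suc (lookup-injective u e)

  Unique-⊆⇒length≤ : ∀ {xs ys : List A} → Unique xs → xs ⊆ ys → length xs ≤ length ys
  Unique-⊆⇒length≤ xs! xs⊆ys = injective⇒≤ λ e →
    lookup-injective xs! (index-injective (setoid A) (xs⊆ys (∈-lookup _)) (xs⊆ys (∈-lookup _)) e)

  ∈-applyUpTo-shift⁺ : ∀ (f : ℕ → A) {m i} l → m ≤ i → i ∸ l ≤ m →
                       f i ∈ applyUpTo (λ d → f (m + d)) (suc l)
  ∈-applyUpTo-shift⁺ f {m} {i} l m≤i i∸l≤m =
    subst (λ j → f j ∈ _) (m+[n∸m]≡n m≤i)
      (∈-applyUpTo⁺ (λ d → f (m + d)) (s≤s (m≤n+o⇒m∸n≤o i m i≤m+l)))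
    where
    i≤m+l : i ≤ m + l
    i≤m+l = ≤-trans (m≤n+m∸n i l) (≤-trans (+-monoʳ-≤ l i∸l≤m) (≤-reflexive (+-comm l m)))

allFin² : ∀ {a b} → List (Fin a × Fin b)
allFin² = cartesianProduct (allFin _) (allFin _)

∈-allFin² : ∀ {a b} (i : Fin a) (j : Fin b) → (i , j) ∈ allFin²
∈-allFin² i j = ∈-cartesianProduct⁺ (∈-allFin i) (∈-allFin j)

allFin³ : ∀ {a b c} → List ((Fin a × Fin b) × Fin c)
allFin³ = cartesianProduct allFin² (allFin _)

∈-allFin³ : ∀ {a b c} (i : Fin a) (j : Fin b) (l : Fin c) → ((i , j) , l) ∈ allFin³
∈-allFin³ i j l = ∈-cartesianProduct⁺ (∈-allFin² i j) (∈-allFin l)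

m≤n≤1+m⇒n≡m⊎n≡1+m : ∀ {m n} → m ≤ n → n ≤ suc m → n ≡ m ⊎ n ≡ suc m
m≤n≤1+m⇒n≡m⊎n≡1+m m≤n n≤1+m with m≤n⇒m<n∨m≡n m≤n
... | inj₁ m<n = inj₂ (≤-antisym n≤1+m m<n)
... | inj₂ m≡n = inj₁ (sym m≡n)

toℕ-suc-mod : ∀ {N} (w : Fin (suc N)) →
              toℕ (suc (toℕ w) mod suc N) ≡ suc (toℕ w) ⊎ toℕ (suc (toℕ w) mod suc N) ≡ 0
toℕ-suc-mod {N} w with m≤n⇒m<n∨m≡n (toℕ<n w)
... | inj₁ 1+w<N = inj₁ (trans (toℕ-fromℕ< _) (m<n⇒m%n≡m 1+w<N))
... | inj₂ 1+w≡N = inj₂ (trans (toℕ-fromℕ< _) (trans (cong (_% suc N) 1+w≡N) (n%n≡0 (suc N))))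

module Intervals {V : Set} (_≟_ : DecidableEquality V)
  (vertices : List V) (∈-vertices : ∀ v → v ∈ vertices) (lo hi : V → ℕ) where

  record Alive (t : ℕ) (v : V) : Set where
    constructor _,_
    field
      lo≤t : lo v ≤ t
      t≤hi : t ≤ hi v

  alive? : ∀ t v → Dec (Alive t v)
  alive? t v = map′ (λ (p , q) → p , q) (λ (p , q) → p , q) ((lo v ≤? t) ×-dec (t ≤? hi v))

  AliveBefore : ℕ → V → Set
  AliveBefore M v = ∃ λ t → t < M × Alive t v

  MeetBefore : ℕ → V → V → Set
  MeetBefore M u v = ∃ λ t → t < M × Alive t u × Alive t v

  bagAt : ℕ → List V
  bagAt t = deduplicate _≟_ (filter (alive? t) vertices)

  ∈-bagAt⁺ : ∀ {t v} → Alive t v → v ∈ bagAt t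
  ∈-bagAt⁺ {t} {v} a = ∈-deduplicate⁺ _≟_ (∈-filter⁺ (alive? t) (∈-vertices v) a)

  ∈-bagAt⁻ : ∀ {t v} → v ∈ bagAt t → Alive t v
  ∈-bagAt⁻ {t} p = proj₂ (∈-filter⁻ (alive? t) {xs = vertices} (∈-deduplicate⁻ _≟_ _ p))

  ∈-bagAt-fromℕ< : ∀ {M t v} (t<M : t < M) → Alive t v → v ∈ bagAt (toℕ (fromℕ< t<M))
  ∈-bagAt-fromℕ< t<M a rewrite toℕ-fromℕ< t<M = ∈-bagAt⁺ a

  length-bagAt≤ : ∀ {C : Set} {code : V → C} → Injective _≡_ _≡_ code → ∀ t {cs} →
                  (∀ {v} → Alive t v → code v ∈ cs) → length (bagAt t) ≤ length cs
  length-bagAt≤ {code = code} code-injective t {cs} alive⇒∈cs = begin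
    length (bagAt t)            ≡⟨ length-map code (bagAt t) ⟨
    length (map code (bagAt t)) ≤⟨ Unique-⊆⇒length≤ codes-unique codes⊆cs ⟩
    length cs                   ∎
    where
    open ≤-Reasoning
    codes-unique : Unique (map code (bagAt t))
    codes-unique = Unique.map⁺ code-injective (deduplicate-! _≟_ _)
    codes⊆cs : map code (bagAt t) ⊆ cs
    codes⊆cs p with v , v∈ , refl ← ∈-map⁻ code p = alive⇒∈cs (∈-bagAt⁻ v∈)

  pathwidth≤ : ∀ {E : V → V → Set} (M w : ℕ) →
    (∀ v → AliveBefore M v) → (∀ u v → E u v → MeetBefore M u v) →
    ∀ {C : Set} (code : V → C) → Injective _≡_ _≡_ code →
    (∀ t → ∃ λ (cs : List C) → length cs ≤ suc w × (∀ {v} → Alive t v → code v ∈ cs)) →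
    Pathwidth≤ V E w
  pathwidth≤ M w covered met code code-injective candidates = decomposition , width
    where
    decomposition : PathDecomposition V _
    decomposition = record
      { m       = M
      ; bag     = bagAt ∘ toℕ
      ; bagSet  = λ t → deduplicate-! _≟_ _
      ; covers  = λ v → let (t , t<M , a) = covered v in fromℕ< t<M , ∈-bagAt-fromℕ< t<M a
      ; edges   = λ u v e → let (t , t<M , a , b) = met u v e in
                    fromℕ< t<M , ∈-bagAt-fromℕ< t<M a , ∈-bagAt-fromℕ< t<M b
      ; subpath = λ v a b c a≤b b≤c p q →
          ∈-bagAt⁺ (≤-trans (Alive.lo≤t (∈-bagAt⁻ p)) a≤b ,
                    ≤-trans b≤c (Alive.t≤hi (∈-bagAt⁻ q)))
      }

    width : HasWidth≤ decomposition w
    width t = let (cs , |cs|≤1+w , alive⇒∈cs) = candidates (toℕ t) in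
      ≤-trans (length-bagAt≤ code-injective (toℕ t) alive⇒∈cs) |cs|≤1+w

module Blocks (L : ℕ) where

  infixl 6 _⊕_
  _⊕_ : ℕ → ℕ → ℕ
  g ⊕ s = g * L + s

  /⊕%≡ : ∀ t .{{_ : NonZero L}} → t / L ⊕ t % L ≡ t
  /⊕%≡ t = trans (+-comm (t / L * L) (t % L)) (sym (m≡m%n+[m/n]*n t L))

  ⊕-mono-≤ : ∀ {h g x y} → h ≤ g → x ≤ y → h ⊕ x ≤ g ⊕ y
  ⊕-mono-≤ h≤g x≤y = +-mono-≤ (*-monoˡ-≤ L h≤g) x≤y

  ⊕-monoʳ-≤ : ∀ h {x y} → x ≤ y → h ⊕ x ≤ h ⊕ y
  ⊕-monoʳ-≤ h = +-monoʳ-≤ (h * L)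

  ⊕<1+⊕0 : ∀ h {x} → x < L → h ⊕ x < suc h ⊕ 0
  ⊕<1+⊕0 h {x} x<L = begin-strict
    h * L + x  <⟨ +-monoʳ-< (h * L) x<L ⟩
    h * L + L  ≡⟨ +-comm (h * L) L ⟩
    suc h * L  ≡⟨ +-identityʳ (suc h * L) ⟨
    suc h ⊕ 0  ∎
    where open ≤-Reasoning

  ⊕-earlier : ∀ {h g x y} → h < g → x < L → h ⊕ x ≤ g ⊕ y
  ⊕-earlier {h} h<g x<L = <⇒≤ (<-≤-trans (⊕<1+⊕0 h x<L) (⊕-mono-≤ h<g z≤n))

  ⊕<* : ∀ {h B x} → h < B → x < L → h ⊕ x < B * L
  ⊕<* {h} {B} h<B x<L =
    <-≤-trans (⊕<1+⊕0 h x<L) (≤-trans (⊕-mono-≤ h<B z≤n) (≤-reflexive (+-identityʳ (B * L))))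

  ⊕-block-≤ : ∀ h g {x s} → h ⊕ x ≤ g ⊕ s → s < L → h ≤ g
  ⊕-block-≤ h g h⊕x≤g⊕s s<L with h ≤? g
  ... | yes h≤g = h≤g
  ... | no  h≰g =
    contradiction h⊕x≤g⊕s (<⇒≱ (<-≤-trans (⊕<1+⊕0 g s<L) (⊕-mono-≤ (≰⇒> h≰g) z≤n)))

  ⊕-sameBlock : ∀ h g {x y s} → h ⊕ x ≤ g ⊕ s → g ⊕ s ≤ h ⊕ y → s < L → y < L →
                h ≡ g × x ≤ s × s ≤ y
  ⊕-sameBlock h g lo≤ ≤hi s<L y<L with ≤-antisym (⊕-block-≤ h g lo≤ s<L) (⊕-block-≤ g h ≤hi y<L)
  ... | refl = refl , +-cancelˡ-≤ (h * L) _ _ lo≤ , +-cancelˡ-≤ (h * L) _ _ ≤hi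

module Grid (k : ℕ) where

  κ : ℕ
  κ = suc k

  gadget : Fin κ → Fin κ → ℕ
  gadget i j = toℕ (combine i j)

  gadget<κ² : ∀ i j → gadget i j < κ * κ
  gadget<κ² i j = toℕ<n (combine i j)

  gadget-injective : ∀ {i j i′ j′} → gadget i j ≡ gadget i′ j′ → i ≡ i′ × j ≡ j′
  gadget-injective {i} {j} {i′} {j′} e =
    combine-injectiveˡ i j i′ j′ (toℕ-injective e) , combine-injectiveʳ i j i′ j′ (toℕ-injective e)

  gadget-right : ∀ i (b : Fin k) → gadget i (Fin.suc b) ≡ suc (gadget i (inject₁ b))
  gadget-right i b = begin
    toℕ (combine i (Fin.suc b))          ≡⟨ toℕ-combine i (Fin.suc b) ⟩
    κ * toℕ i + suc (toℕ b)              ≡⟨ +-suc (κ * toℕ i) (toℕ b) ⟩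
    suc (κ * toℕ i + toℕ b)              ≡⟨ cong (λ x → suc (κ * toℕ i + x)) (toℕ-inject₁ b) ⟨
    suc (κ * toℕ i + toℕ (inject₁ b))    ≡⟨ cong suc (toℕ-combine i (inject₁ b)) ⟨
    suc (toℕ (combine i (inject₁ b)))    ∎
    where open ≡-Reasoning

  gadget-below : ∀ (a : Fin k) j → gadget (Fin.suc a) j ≡ gadget (inject₁ a) j + κ
  gadget-below a j = begin
    toℕ (combine (Fin.suc a) j)          ≡⟨ toℕ-combine (Fin.suc a) j ⟩
    κ * suc (toℕ a) + toℕ j              ≡⟨ cong (_+ toℕ j) (*-suc κ (toℕ a)) ⟩
    κ + κ * toℕ a + toℕ j                ≡⟨ +-assoc κ (κ * toℕ a) (toℕ j) ⟩
    κ + (κ * toℕ a + toℕ j)              ≡⟨ +-comm κ _ ⟩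
    κ * toℕ a + toℕ j + κ                ≡⟨ cong (λ x → κ * x + toℕ j + κ) (toℕ-inject₁ a) ⟨
    κ * toℕ (inject₁ a) + toℕ j + κ      ≡⟨ cong (_+ κ) (toℕ-combine (inject₁ a) j) ⟨
    toℕ (combine (inject₁ a) j) + κ      ∎
    where open ≡-Reasoning

  gadget-left∸1 : ∀ i (b : Fin k) → gadget i (Fin.suc b) ∸ 1 ≡ gadget i (inject₁ b)
  gadget-left∸1 i b = cong (_∸ 1) (gadget-right i b)

  gadget-above∸κ : ∀ (a : Fin k) j → gadget (Fin.suc a) j ∸ κ ≡ gadget (inject₁ a) j
  gadget-above∸κ a j = trans (cong (_∸ κ) (gadget-below a j)) (m+n∸n≡m _ κ)

  gadget-left< : ∀ i (b : Fin k) → gadget i (inject₁ b) < gadget i (Fin.suc b)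
  gadget-left< i b = ≤-reflexive (sym (gadget-right i b))

  gadget-above< : ∀ (a : Fin k) j → gadget (inject₁ a) j < gadget (Fin.suc a) j
  gadget-above< a j = subst (gadget (inject₁ a) j <_) (sym (gadget-below a j)) (m<m+n _ (s≤s z≤n))

module Layout (k n : ℕ) where

  open Grid k

  cycleVertices xVertices yVertices hPathVertices vPathVertices vertices : List (Vtx k n)
  cycleVertices = map (uncurry (uncurry cyc)) allFin³
  xVertices     = map (uncurry (uncurry xv)) allFin³
  yVertices     = map (uncurry yv) allFin²
  hPathVertices = map (uncurry (uncurry hp)) allFin³
  vPathVertices = map (uncurry (uncurry vp)) allFin³
  vertices      = cycleVertices ++ xVertices ++ yVertices ++ hPathVertices ++ vPathVertices

  ∈-vertices : ∀ v → v ∈ vertices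
  ∈-vertices (cyc i j w) = ∈-++⁺ˡ (∈-map⁺ (uncurry (uncurry cyc)) (∈-allFin³ i j w))
  ∈-vertices (xv r i j)  = ∈-++⁺ʳ cycleVertices
    (∈-++⁺ˡ (∈-map⁺ (uncurry (uncurry xv)) (∈-allFin³ r i j)))
  ∈-vertices (yv i j)    = ∈-++⁺ʳ cycleVertices (∈-++⁺ʳ xVertices
    (∈-++⁺ˡ (∈-map⁺ (uncurry yv) (∈-allFin² i j))))
  ∈-vertices (hp i b q)  = ∈-++⁺ʳ cycleVertices (∈-++⁺ʳ xVertices (∈-++⁺ʳ yVertices
    (∈-++⁺ˡ (∈-map⁺ (uncurry (uncurry hp)) (∈-allFin³ i b q)))))
  ∈-vertices (vp a j q)  = ∈-++⁺ʳ cycleVertices (∈-++⁺ʳ xVertices (∈-++⁺ʳ yVertices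
    (∈-++⁺ʳ hPathVertices (∈-map⁺ (uncurry (uncurry vp)) (∈-allFin³ a j q)))))

  Code : Set
  Code = ℕ × ℕ × ℕ

  code : Vtx k n → Code
  code (cyc i j w) = gadget i j , toℕ w , 0
  code (yv i j)    = gadget i j , 0 , 1
  code (xv r i j)  = gadget i j , toℕ r , 2
  code (vp a j q)  = gadget (inject₁ a) j , toℕ q , 3
  code (hp i b q)  = gadget i (inject₁ b) , toℕ q , 4

  code-injective : Injective _≡_ _≡_ code
  code-injective {cyc i j w} {cyc i′ j′ w′} e
    with refl , refl ← gadget-injective {i} {j} {i′} {j′} (cong proj₁ e)
    = cong (cyc i j) (toℕ-injective (cong (proj₁ ∘ proj₂) e))
  code-injective {yv i j} {yv i′ j′} e
    with refl , refl ← gadget-injective {i} {j} {i′} {j′} (cong proj₁ e)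
    = refl
  code-injective {xv r i j} {xv r′ i′ j′} e
    with refl , refl ← gadget-injective {i} {j} {i′} {j′} (cong proj₁ e)
    = cong (λ r → xv r i j) (toℕ-injective (cong (proj₁ ∘ proj₂) e))
  code-injective {vp a j q} {vp a′ j′ q′} e
    with a≡a′ , refl ← gadget-injective {inject₁ a} {j} {inject₁ a′} {j′} (cong proj₁ e)
    with refl ← inject₁-injective a≡a′
    = cong (vp a j) (toℕ-injective (cong (proj₁ ∘ proj₂) e))
  code-injective {hp i b q} {hp i′ b′ q′} e
    with refl , b≡b′ ← gadget-injective {i} {inject₁ b} {i′} {inject₁ b′} (cong proj₁ e)
    with refl ← inject₁-injective b≡b′
    = cong (hp i b) (toℕ-injective (cong (proj₁ ∘ proj₂) e))
  code-injective {cyc _ _ _} {yv _ _}    ()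
  code-injective {cyc _ _ _} {xv _ _ _}  ()
  code-injective {cyc _ _ _} {vp _ _ _}  ()
  code-injective {cyc _ _ _} {hp _ _ _}  ()
  code-injective {yv _ _}    {cyc _ _ _} ()
  code-injective {yv _ _}    {xv _ _ _}  ()
  code-injective {yv _ _}    {vp _ _ _}  ()
  code-injective {yv _ _}    {hp _ _ _}  ()
  code-injective {xv _ _ _}  {cyc _ _ _} ()
  code-injective {xv _ _ _}  {yv _ _}    ()
  code-injective {xv _ _ _}  {vp _ _ _}  ()
  code-injective {xv _ _ _}  {hp _ _ _}  ()
  code-injective {vp _ _ _}  {cyc _ _ _} ()
  code-injective {vp _ _ _}  {yv _ _}    ()
  code-injective {vp _ _ _}  {xv _ _ _}  ()
  code-injective {vp _ _ _}  {hp _ _ _}  ()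
  code-injective {hp _ _ _}  {cyc _ _ _} ()
  code-injective {hp _ _ _}  {yv _ _}    ()
  code-injective {hp _ _ _}  {xv _ _ _}  ()
  code-injective {hp _ _ _}  {vp _ _ _}  ()

  _≟_ : DecidableEquality (Vtx k n)
  u ≟ v = map′ code-injective (cong code) (≡-dec ℕ._≟_ (≡-dec ℕ._≟_ ℕ._≟_) (code u) (code v))

  -- P′_{i,j} is walked at offsets V₀, …, V₀ + n + 1 of block (i,j), and P_{i,j} at
  -- offsets H₀, …, H₀ + n + 1.
  V₀ H₀ L : ℕ
  V₀ = cycLen n
  H₀ = 2 + (V₀ + n)
  L  = 2 + (H₀ + n)

  open Blocks L

  V₀<H₀ : V₀ < H₀
  V₀<H₀ = s≤s (m≤n⇒m≤1+n (m≤m+n V₀ n))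

  V₀≤H₀ : V₀ ≤ H₀
  V₀≤H₀ = <⇒≤ V₀<H₀

  H₀<L : H₀ < L
  H₀<L = s≤s (m≤n⇒m≤1+n (m≤m+n H₀ n))

  0<L : 0 < L
  0<L = s≤s z≤n

  cycle≤H₀ : (w : Fin V₀) → toℕ w ≤ H₀
  cycle≤H₀ w = <⇒≤ (<-trans (toℕ<n w) V₀<H₀)

  cycle<L : (w : Fin V₀) → toℕ w < L
  cycle<L w = <-trans (toℕ<n w) (<-trans V₀<H₀ H₀<L)

  1+D+p<L : ∀ {D p} → D ≤ H₀ → p ≤ n → suc (D + p) < L
  1+D+p<L D≤H₀ p≤n = s≤s (s≤s (+-mono-≤ D≤H₀ p≤n))

  D+p<L : ∀ {D p} → D ≤ H₀ → p ≤ n → D + p < L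
  D+p<L D≤H₀ p≤n = <-trans (n<1+n _) (1+D+p<L D≤H₀ p≤n)

  -- x¹_{i,j} and x⁴_{i,j} end the paths starting at the gadgets κ blocks and one block
  -- earlier, and are alive from the start of those blocks.
  lag : Fin 4 → ℕ
  lag 0F = κ
  lag 3F = 1
  lag _  = 0

  -- v₁ is adjacent to the last cycle vertex; the truncated subtraction in lo lets it
  -- start at offset 0.
  cycHi : ℕ → ℕ
  cycHi zero    = H₀
  cycHi (suc w) = suc w

  lo hi : Vtx k n → ℕ
  lo (cyc i j w) = gadget i j ⊕ (toℕ w ∸ 1)
  lo (xv r i j)  = (gadget i j ∸ lag r) ⊕ 0
  lo (yv i j)    = gadget i j ⊕ 0
  lo (hp i b q)  = gadget i (inject₁ b) ⊕ (H₀ + toℕ q)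
  lo (vp a j q)  = gadget (inject₁ a) j ⊕ (V₀ + toℕ q)
  hi (cyc i j w) = gadget i j ⊕ cycHi (toℕ w)
  hi (xv r i j)  = gadget i j ⊕ H₀
  hi (yv i j)    = gadget i j ⊕ H₀
  hi (hp i b q)  = gadget i (inject₁ b) ⊕ suc (H₀ + toℕ q)
  hi (vp a j q)  = gadget (inject₁ a) j ⊕ suc (V₀ + toℕ q)

  cycHi<L : ∀ w → w < V₀ → cycHi w < L
  cycHi<L zero    _    = H₀<L
  cycHi<L (suc w) w<V₀ = <-trans w<V₀ (<-trans V₀<H₀ H₀<L)

  ≤-cycHi : ∀ w → w ≤ cycHi w
  ≤-cycHi zero    = z≤n
  ≤-cycHi (suc w) = ≤-refl

  open Intervals _≟_ vertices ∈-vertices lo hi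

  Span : ℕ → ℕ → ℕ → Set
  Span D p x = D + p ≤ x × x ≤ suc (D + p)

  span-start : ∀ D p → Span D p (D + p)
  span-start D p = ≤-refl , n≤1+n (D + p)

  span-end : ∀ D {p p′} → p ≡ p′ → Span D p (suc (D + p′))
  span-end D {p} refl = n≤1+n (D + p) , ≤-refl

  span-next : ∀ D p → Span D (suc p) (suc (D + p))
  span-next D p = ≤-reflexive (+-suc D p) , s≤s (+-monoʳ-≤ D (n≤1+n p))

  cycleCodes : ℕ → ℕ → List Code
  cycleCodes g s = (g , 0 , 0) ∷ (g , s , 0) ∷ (g , suc s , 0) ∷ []

  pathCodes : ℕ → ℕ → ℕ → ℕ → List Code
  pathCodes D tag g s = (g , s ∸ D , tag) ∷ (g , s ∸ suc D , tag) ∷ []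

  window : Fin 4 → ℕ → List Code
  window r g = applyUpTo (λ d → (g + d , toℕ r , 2)) (suc (lag r))

  -- Only window 0F has a length depending on k; putting it last makes candidates g s
  -- compute to twelve explicit codes followed by it.
  xCodes : ℕ → List Code
  xCodes g = window 1F g ++ window 2F g ++ window 3F g ++ window 0F g

  candidates : ℕ → ℕ → List Code
  candidates g s =
    cycleCodes g s ++ pathCodes V₀ 3 g s ++ pathCodes H₀ 4 g s ++ (g , 0 , 1) ∷ xCodes g

  length-candidates : ∀ g s → length (candidates g s) ≡ suc (κ + 12)
  length-candidates g s =
    trans (cong (12 +_) (length-applyUpTo (λ d → (g + d , 0 , 2)) (suc κ))) (+-comm 12 (suc κ))

  ∈-cycleCodes : ∀ {g s} w → w ∸ 1 ≤ s → s ≤ cycHi w → (g , w , 0) ∈ cycleCodes g s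
  ∈-cycleCodes zero    _   _     = here refl
  ∈-cycleCodes (suc w) w≤s s≤1+w with m≤n≤1+m⇒n≡m⊎n≡1+m w≤s s≤1+w
  ... | inj₁ refl = there (there (here refl))
  ... | inj₂ refl = there (here refl)

  ∈-pathCodes : ∀ {g s} D p tag → Span D p s → (g , p , tag) ∈ pathCodes D tag g s
  ∈-pathCodes {g} D p tag (D+p≤s , s≤1+D+p) with m≤n≤1+m⇒n≡m⊎n≡1+m D+p≤s s≤1+D+p
  ... | inj₁ refl = here (cong (λ x → g , x , tag) (sym (m+n∸m≡n D p)))
  ... | inj₂ refl = there (here (cong (λ x → g , x , tag) (sym (m+n∸m≡n D p))))

  ∈-window : ∀ {g h} r → g ≤ h → h ∸ lag r ≤ g → (h , toℕ r , 2) ∈ window r g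
  ∈-window r = ∈-applyUpTo-shift⁺ (λ h → (h , toℕ r , 2)) (lag r)

  ∈-xCodes : ∀ r {g c} → c ∈ window r g → c ∈ xCodes g
  ∈-xCodes 0F {g} p = ∈-++⁺ʳ (window 1F g) (∈-++⁺ʳ (window 2F g) (∈-++⁺ʳ (window 3F g) p))
  ∈-xCodes 1F     p = ∈-++⁺ˡ p
  ∈-xCodes 2F {g} p = ∈-++⁺ʳ (window 1F g) (∈-++⁺ˡ p)
  ∈-xCodes 3F {g} p = ∈-++⁺ʳ (window 1F g) (∈-++⁺ʳ (window 2F g) (∈-++⁺ˡ p))

  alive⇒∈candidates : ∀ {g s} v → s < L → Alive (g ⊕ s) v → code v ∈ candidates g s
  alive⇒∈candidates {g} {s} (cyc i j w) s<L (lo≤ , ≤hi)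
    with refl , w∸1≤s , s≤hi ← ⊕-sameBlock (gadget i j) g lo≤ ≤hi s<L
                                  (cycHi<L (toℕ w) (toℕ<n w))
    = ∈-++⁺ˡ (∈-cycleCodes (toℕ w) w∸1≤s s≤hi)
  alive⇒∈candidates {g} {s} (vp a j q) s<L (lo≤ , ≤hi)
    with refl , span ← ⊕-sameBlock (gadget (inject₁ a) j) g lo≤ ≤hi s<L
                          (1+D+p<L V₀≤H₀ (toℕ≤pred[n] q))
    = ∈-++⁺ʳ (cycleCodes g s) (∈-++⁺ˡ (∈-pathCodes V₀ (toℕ q) 3 span))
  alive⇒∈candidates {g} {s} (hp i b q) s<L (lo≤ , ≤hi)
    with refl , span ← ⊕-sameBlock (gadget i (inject₁ b)) g lo≤ ≤hi s<L
                          (1+D+p<L ≤-refl (toℕ≤pred[n] q))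
    = ∈-++⁺ʳ (cycleCodes g s) (∈-++⁺ʳ (pathCodes V₀ 3 g s)
        (∈-++⁺ˡ (∈-pathCodes H₀ (toℕ q) 4 span)))
  alive⇒∈candidates {g} {s} (yv i j) s<L (lo≤ , ≤hi)
    with refl , _ ← ⊕-sameBlock (gadget i j) g lo≤ ≤hi s<L H₀<L
    = ∈-++⁺ʳ (cycleCodes g s) (∈-++⁺ʳ (pathCodes V₀ 3 g s)
        (∈-++⁺ʳ (pathCodes H₀ 4 g s) (here refl)))
  alive⇒∈candidates {g} {s} (xv r i j) s<L (lo≤ , ≤hi) =
    ∈-++⁺ʳ (cycleCodes g s) (∈-++⁺ʳ (pathCodes V₀ 3 g s) (∈-++⁺ʳ (pathCodes H₀ 4 g s)
      (there (∈-xCodes r (∈-window r (⊕-block-≤ g _ ≤hi H₀<L) (⊕-block-≤ _ g lo≤ s<L))))))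

  M : ℕ
  M = κ * κ * L

  aliveIn : ∀ {v} i j x → x < L → Alive (gadget i j ⊕ x) v → AliveBefore M v
  aliveIn i j x x<L a = gadget i j ⊕ x , ⊕<* (gadget<κ² i j) x<L , a

  meetIn : ∀ {u v} i j x → x < L → Alive (gadget i j ⊕ x) u → Alive (gadget i j ⊕ x) v →
           MeetBefore M u v
  meetIn i j x x<L a b = gadget i j ⊕ x , ⊕<* (gadget<κ² i j) x<L , a , b

  alive-cyc : ∀ i j w → Alive (gadget i j ⊕ toℕ w) (cyc i j w)
  alive-cyc i j w =
    ⊕-monoʳ-≤ (gadget i j) (m∸n≤m (toℕ w) 1) , ⊕-monoʳ-≤ (gadget i j) (≤-cycHi (toℕ w))

  alive-cyc-successor : ∀ i j (w : Fin V₀) →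
                        Alive (gadget i j ⊕ toℕ w) (cyc i j (suc (toℕ w) mod V₀))
  alive-cyc-successor i j w = ⊕-monoʳ-≤ (gadget i j) lo≤ , ⊕-monoʳ-≤ (gadget i j) ≤hi
    where
    lo≤ : toℕ (suc (toℕ w) mod V₀) ∸ 1 ≤ toℕ w
    lo≤ with toℕ-suc-mod w
    ... | inj₁ w′≡1+w = ≤-reflexive (cong (_∸ 1) w′≡1+w)
    ... | inj₂ w′≡0   = subst (λ x → x ∸ 1 ≤ toℕ w) (sym w′≡0) z≤n
    ≤hi : toℕ w ≤ cycHi (toℕ (suc (toℕ w) mod V₀))
    ≤hi with toℕ-suc-mod w
    ... | inj₁ w′≡1+w = subst (λ x → toℕ w ≤ cycHi x) (sym w′≡1+w) (n≤1+n (toℕ w))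
    ... | inj₂ w′≡0   = subst (λ x → toℕ w ≤ cycHi x) (sym w′≡0) (cycle≤H₀ w)

  alive-y : ∀ i j {x} → x ≤ H₀ → Alive (gadget i j ⊕ x) (yv i j)
  alive-y i j x≤H₀ = ⊕-monoʳ-≤ (gadget i j) z≤n , ⊕-monoʳ-≤ (gadget i j) x≤H₀

  alive-x : ∀ r i j {x} → x ≤ H₀ → Alive (gadget i j ⊕ x) (xv r i j)
  alive-x r i j {x} x≤H₀ =
    ⊕-mono-≤ (m∸n≤m (gadget i j) (lag r)) (z≤n {x}) , ⊕-monoʳ-≤ (gadget i j) x≤H₀

  alive-x-early : ∀ r i j {h x} → gadget i j ∸ lag r ≡ h → h < gadget i j → x < L →
                  Alive (h ⊕ x) (xv r i j)
  alive-x-early r i j {x = x} G∸lag≡h h<G x<L =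
    ⊕-mono-≤ (≤-reflexive G∸lag≡h) (z≤n {x}) , ⊕-earlier h<G x<L

  alive-hp : ∀ i b q {x} → Span H₀ (toℕ q) x → Alive (gadget i (inject₁ b) ⊕ x) (hp i b q)
  alive-hp i b q (lo≤ , ≤hi) =
    ⊕-monoʳ-≤ (gadget i (inject₁ b)) lo≤ , ⊕-monoʳ-≤ (gadget i (inject₁ b)) ≤hi

  alive-vp : ∀ a j q {x} → Span V₀ (toℕ q) x → Alive (gadget (inject₁ a) j ⊕ x) (vp a j q)
  alive-vp a j q (lo≤ , ≤hi) =
    ⊕-monoʳ-≤ (gadget (inject₁ a) j) lo≤ , ⊕-monoʳ-≤ (gadget (inject₁ a) j) ≤hi

  covered : ∀ v → AliveBefore M v
  covered (cyc i j w) = aliveIn i j (toℕ w) (cycle<L w) (alive-cyc i j w)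
  covered (xv r i j)  = aliveIn i j 0 0<L (alive-x r i j z≤n)
  covered (yv i j)    = aliveIn i j 0 0<L (alive-y i j z≤n)
  covered (hp i b q)  = aliveIn i (inject₁ b) (H₀ + toℕ q) (D+p<L ≤-refl (toℕ≤pred[n] q))
    (alive-hp i b q (span-start H₀ (toℕ q)))
  covered (vp a j q)  = aliveIn (inject₁ a) j (V₀ + toℕ q) (D+p<L V₀≤H₀ (toℕ≤pred[n] q))
    (alive-vp a j q (span-start V₀ (toℕ q)))

  y-meets-cycle : ∀ i j w → MeetBefore M (yv i j) (cyc i j w)
  y-meets-cycle i j w = meetIn i j (toℕ w) (cycle<L w) (alive-y i j (cycle≤H₀ w)) (alive-cyc i j w)

  x-meets-cycle : ∀ r i j w → MeetBefore M (xv r i j) (cyc i j w)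
  x-meets-cycle r i j w = meetIn i j (toℕ w) (cycle<L w) (alive-x r i j (cycle≤H₀ w)) (alive-cyc i j w)

  met : (I : GTI k n) → ∀ u v → Edge I u v → MeetBefore M u v
  met I _ _ (cycE i j w)    = meetIn i j (toℕ w) (cycle<L w)
    (alive-cyc i j w) (alive-cyc-successor i j w)
  met I _ _ (yE1 i j)       = y-meets-cycle i j _
  met I _ _ (yE2 i j)       = y-meets-cycle i j _
  met I _ _ (yE3 i j)       = y-meets-cycle i j _
  met I _ _ (yE4 i j)       = y-meets-cycle i j _
  met I _ _ (xE1 i j _ _ _) = x-meets-cycle 0F i j _
  met I _ _ (xE2 i j _ _ _) = x-meets-cycle 1F i j _
  met I _ _ (xE3 i j _ _ _) = x-meets-cycle 2F i j _
  met I _ _ (xE4 i j _ _ _) = x-meets-cycle 3F i j _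
  met I _ _ (hStart i b)    = meetIn i (inject₁ b) (H₀ + 0) (D+p<L ≤-refl z≤n)
    (alive-x 1F i (inject₁ b) (≤-reflexive (+-identityʳ H₀)))
    (alive-hp i b 0F (span-start H₀ 0))
  met I _ _ (hStep i b q)   = meetIn i (inject₁ b) (suc (H₀ + toℕ q)) (1+D+p<L ≤-refl (toℕ≤n q))
    (alive-hp i b (inject₁ q) (span-end H₀ (toℕ-inject₁ q)))
    (alive-hp i b (Fin.suc q) (span-next H₀ (toℕ q)))
  met I _ _ (hEnd i b)      = meetIn i (inject₁ b) (suc (H₀ + n)) (1+D+p<L ≤-refl ≤-refl)
    (alive-hp i b (fromℕ n) (span-end H₀ (toℕ-fromℕ n)))
    (alive-x-early 3F i (Fin.suc b) (gadget-left∸1 i b) (gadget-left< i b)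
      (1+D+p<L ≤-refl ≤-refl))
  met I _ _ (vStart a j)    = meetIn (inject₁ a) j (V₀ + 0) (D+p<L V₀≤H₀ z≤n)
    (alive-x 2F (inject₁ a) j (≤-trans (≤-reflexive (+-identityʳ V₀)) V₀≤H₀))
    (alive-vp a j 0F (span-start V₀ 0))
  met I _ _ (vStep a j q)   = meetIn (inject₁ a) j (suc (V₀ + toℕ q)) (1+D+p<L V₀≤H₀ (toℕ≤n q))
    (alive-vp a j (inject₁ q) (span-end V₀ (toℕ-inject₁ q)))
    (alive-vp a j (Fin.suc q) (span-next V₀ (toℕ q)))
  met I _ _ (vEnd a j)      = meetIn (inject₁ a) j (suc (V₀ + n)) (1+D+p<L V₀≤H₀ ≤-refl)
    (alive-vp a j (fromℕ n) (span-end V₀ (toℕ-fromℕ n)))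
    (alive-x-early 0F (Fin.suc a) j (gadget-above∸κ a j) (gadget-above< a j)
      (1+D+p<L V₀≤H₀ ≤-refl))

  bag-candidates : ∀ t → ∃ λ (cs : List Code) →
                   length cs ≤ suc (κ + 12) × (∀ {v} → Alive t v → code v ∈ cs)
  bag-candidates t =
    candidates (t / L) (t % L) , ≤-reflexive (length-candidates (t / L) (t % L)) ,
    λ {v} a → alive⇒∈candidates v (m%n<n t L) (subst (λ u → Alive u v) (sym (/⊕%≡ t)) a)

  pathwidth≤κ+12 : (I : GTI k n) → Pathwidth≤ (Vtx k n) (Edge I) (κ + 12)
  pathwidth≤κ+12 I = pathwidth≤ M (κ + 12) covered (met I) code code-injective bag-candidates

lemma3 : ∃ λ (c : ℕ) → ∀ (k n : ℕ) (I : GTI k n) →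
           Pathwidth≤ (Vtx k n) (Edge I) (suc k + c)
lemma3 = 12 , λ k n I → Layout.pathwidth≤κ+12 k n I
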